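{- Let $\mathfrak{T}=(T;<)$ be a finitely branching$_2$ tree. Then the condensation $[\mathfrak{T}]$ is well-founded.
   Context: A forest is a strict partial order $(F;<)$ such that for every $x$ the set $\{y:y<x\}$ is linearly ordered; a tree is a forest that is downward-connected: for all $x,y$ there is $z$ with $z\leqslant x$ and $z\leqslant y$. Trees are not assumed well-founded or rooted. A path is a maximal linearly ordered set of nodes. A stem is a nonempty linearly ordered set of nodes that is downward-closed and bounded above. An antichain is a set of pairwise incomparable nodes. For sets $X,Y$ of nodes, $X$ underlies $Y$ if for every $u\in Y$ there is $v\in X$ with $v\leqslant u$. For a stem $S$, or $S=\emptyset$, let $T^{>S}=\{x\in T: s<x \text{ for all } s\in S\}$ (so $T^{>\emptyset}=T$). For $n\in\mathbb{N}$, $\mathfrak{T}$ is $n$-branching$_2$ at $S$ if for every antichain $X\subseteq T^{>S}$ there is an antichain $L_X\subseteq T^{>S}$ that underlies $X$ and has exactly $n$ elements; it is finitely branching$_2$ at $S$ if it is $n$-branching$_2$ at $S$ for some $n$. The tree is finitely branching$_2$ if it is finitely branching$_2$ at $\emptyset$ and at every stem. A set $A$ is convex if $x<z<y$ with $x,y\in A$ implies $z\in A$; a bridge is a nonempty convex linearly ordered set $B$ such that for every path $P$, either $B\subseteq P$ or $B\cap P=\emptyset$. Every node $t$ lies in a unique maximal bridge $[t]$. For sets $A,B$ write $A<B$ if $x<y$ for all $x\in A,y\in B$. The condensation $[\mathfrak{T}]$ is $\{[t]:t\in T\}$ ordered by this relation; it is a tree. A partial order is well-founded if every nonempty subset has a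 minimal element. -}

module Defs where

open import Level using (0ℓ)
open import Data.Nat using (ℕ)
open import Data.Fin using (Fin)
open import Data.Product using (Σ; ∃; _×_; _,_)
open import Data.Sum using (_⊎_)
open import Data.Empty using (⊥)
open import Relation.Nullary using (¬_)
open import Relation.Binary.PropositionalEquality using (_≡_)
open import Relation.Binary.Structures using (IsStrictPartialOrder)
open import Function.Definitions using (Injective)

Pred : Set → Set₁
Pred T = T → Set

module TreeNotions {T : Set} (_<_ : T → T → Set) where

  _≤_ : T → T → Set
  x ≤ y = (x < y) ⊎ (x ≡ y)

  _⊆_ : Pred T → Pred T → Set
  A ⊆ B = ∀ x → A x → B x

  ∅ : Pred T
  ∅ _ = ⊥

  Linear : Pred T → Set
  Linear A = ∀ x y → A x → A y → (x < y) ⊎ (x ≡ y) ⊎ (y < x)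

  IsForest : Set
  IsForest = IsStrictPartialOrder _≡_ _<_ × (∀ x → Linear (λ y → y < x))

  IsTree : Set
  IsTree = IsForest × (∀ x y → ∃ λ z → (z ≤ x) × (z ≤ y))

  IsPath : Pred T → Set₁
  IsPath P = Linear P × (∀ Q → Linear Q → P ⊆ Q → Q ⊆ P)

  IsStem : Pred T → Set
  IsStem S = (∃ λ s → S s) × Linear S
           × (∀ x y → y < x → S x → S y)
           × (∃ λ b → ∀ s → S s → s ≤ b)

  Antichain : Pred T → Set
  Antichain X = ∀ x y → X x → X y → ¬ (x < y)

  Underlies : Pred T → Pred T → Set
  Underlies X Y = ∀ u → Y u → ∃ λ v → X v × (v ≤ u)

  Above : Pred T → Pred T
  Above S x = ∀ s → S s → s < x

  HasSize : Pred T → ℕ → Set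
  HasSize L n = Σ (Fin n → T) λ f → Injective _≡_ _≡_ f
                  × (∀ x → L x → ∃ λ i → f i ≡ x)
                  × (∀ i → L (f i))

  NBranching₂At : ℕ → Pred T → Set₁
  NBranching₂At n S = ∀ X → X ⊆ Above S → Antichain X →
    Σ (Pred T) λ L → L ⊆ Above S × Antichain L × Underlies L X × HasSize L n

  FinBranching₂At : Pred T → Set₁
  FinBranching₂At S = Σ ℕ λ n → NBranching₂At n S

  FinitelyBranching₂ : Set₁
  FinitelyBranching₂ = FinBranching₂At ∅ × (∀ S → IsStem S → FinBranching₂At S)

  Convex : Pred T → Set
  Convex A = ∀ x y z → A x → A y → x < z → z < y → A z

  IsBridge : Pred T → Set₁
  IsBridge B = (∃ λ x → B x) × Convex B × Linear B
             × (∀ P → IsPath P → (B ⊆ P) ⊎ (∀ x → B x → P x → ⊥))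

  -- [t]: the maximal bridge containing t, i.e. the union of all bridges containing t
  Class : T → T → Set₁
  Class t u = Σ (Pred T) λ B → IsBridge B × B t × B u

  -- order on the condensation: [x] < [y]
  _<c_ : T → T → Set₁
  x <c y = ∀ a b → Class x a → Class y b → a < b

  -- the condensation is well-founded: every nonempty set of classes
  -- {[t] : P t} has a minimal element
  CondensationWellFounded : Set₂
  CondensationWellFounded =
    ∀ (P : T → Set₁) → (∃ λ t → P t) →
      ∃ λ m → P m × (∀ y → P y → ¬ (y <c m))

{-# OPTIONS --safe #-}
module Submission where

-- If the condensation had no minimal element, there would be nodes m₀ > m₁ > ⋯
-- lying in pairwise distinct maximal bridges. Since [mₖ₊₁, mₖ] is not a bridge,
-- some xₖ > mₖ₊₁ is incomparable with mₖ, and the xₖ form an antichain. Let S be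
-- the set of nodes below every mₖ (a stem, or empty). Finite branching at S gives
-- n nodes above S underlying all xₖ; each of them lies above some mₖ, so above
-- a common m_K, which then lies below x_K — contradicting the choice of x_K.

open import Defs
open import Level using (0ℓ; suc)
open import Axiom.ExcludedMiddle using (ExcludedMiddle)
open import Data.Nat using (ℕ; zero; z≤n; _⊔_; _≤′_; ≤′-refl; ≤′-step)
  renaming (suc to 1+; _≤_ to _≤ℕ_; _<_ to _<ℕ_)
open import Data.Nat.Properties using (m≤m⊔n; m≤n⊔m; ≤⇒≤′; <-cmp)
open import Data.Fin using (Fin) renaming (zero to fzero; suc to fsuc)
open import Data.Product using (Σ; ∃; _×_; _,_; proj₁; proj₂)
open import Data.Sum using (_⊎_; inj₁; inj₂)
open import Data.Empty using (⊥; ⊥-elim)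
open import Relation.Nullary using (¬_; yes; no)
open import Relation.Binary.PropositionalEquality using (_≡_; refl; sym)
open import Relation.Binary.Structures using (IsStrictPartialOrder; IsPartialOrder)
open import Relation.Binary.Definitions using (tri<; tri≈; tri>)
import Relation.Binary.Construct.StrictToNonStrict as StrictToNonStrict
open import Function using (_∘_)
open import Axiom.DoubleNegationElimination using (em⇒dne)

common-witness : ExcludedMiddle 0ℓ → ∀ n (Q : Fin n → ℕ → Set) →
  (∀ i {k k′} → k ≤ℕ k′ → Q i k → Q i k′) →
  ∃ λ K → ∀ i → ∃ (Q i) → Q i K
common-witness em zero Q mono = 0 , λ ()
common-witness em (1+ n) Q mono with common-witness em n (λ i → Q (fsuc i)) (λ i → mono (fsuc i))
... | K , K-works with em {∃ (Q fzero)}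
...   | no ¬q₀ = K , λ { fzero q → ⊥-elim (¬q₀ q) ; (fsuc i) q → K-works i q }
...   | yes (k , q₀) = k ⊔ K , λ
  { fzero _ → mono fzero (m≤m⊔n k K) q₀
  ; (fsuc i) q → mono (fsuc i) (m≤n⊔m k K) (K-works i q) }

descending-sequence : ∀ {a p r} {A : Set a} (P : A → Set p) (R : A → A → Set r) →
  (∀ x → P x → Σ A λ y → P y × R y x) → ∀ {x} → P x →
  Σ (ℕ → A) λ s → ∀ k → R (s (1+ k)) (s k)
descending-sequence {A = A} P R step {x} px = proj₁ ∘ seq , λ k → proj₂ (proj₂ (step _ (proj₂ (seq k))))
  where
  seq : ℕ → Σ A P
  seq zero = x , px
  seq (1+ k) = let (y , py , _) = step _ (proj₂ (seq k)) in y , py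

module TreeLemmas (em : ExcludedMiddle 0ℓ) {T : Set} {_<_ : T → T → Set}
                  (isTree : TreeNotions.IsTree _<_) where
  open TreeNotions _<_

  private
    isSPO : IsStrictPartialOrder _≡_ _<_
    isSPO = proj₁ (proj₁ isTree)

    open IsStrictPartialOrder isSPO using (irrefl; trans; <-respʳ-≈; <-respˡ-≈)
    module NonStrict = StrictToNonStrict _≡_ _<_
    open IsPartialOrder (NonStrict.isPartialOrder isSPO) using () renaming (trans to ≤-trans)

    <-≤-trans : ∀ {a b c} → a < b → b ≤ c → a < c
    <-≤-trans = NonStrict.<-≤-trans trans <-respʳ-≈

    ≤-<-trans : ∀ {a b c} → a ≤ b → b < c → a < c
    ≤-<-trans = NonStrict.≤-<-trans sym trans <-respˡ-≈

  Comparable : T → T → Set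
  Comparable a b = (a < b) ⊎ (a ≡ b) ⊎ (b < a)

  comparable-sym : ∀ {a b} → Comparable a b → Comparable b a
  comparable-sym (inj₁ a<b) = inj₂ (inj₂ a<b)
  comparable-sym (inj₂ (inj₁ refl)) = inj₂ (inj₁ refl)
  comparable-sym (inj₂ (inj₂ b<a)) = inj₁ b<a

  ≤⇒comparable : ∀ {a b} → a ≤ b → Comparable a b
  ≤⇒comparable (inj₁ a<b) = inj₁ a<b
  ≤⇒comparable (inj₂ a≡b) = inj₂ (inj₁ a≡b)

  comparable-below : ∀ {a b c} → a ≤ c → b ≤ c → Comparable a b
  comparable-below {c = c} (inj₁ a<c) (inj₁ b<c) = proj₂ (proj₁ isTree) c _ _ a<c b<c
  comparable-below (inj₁ a<c) (inj₂ refl) = inj₁ a<c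
  comparable-below (inj₂ refl) b≤c = comparable-sym (≤⇒comparable b≤c)

  path-contains-comparable : ∀ {P} → IsPath P → ∀ w → (∀ p → P p → Comparable p w) → P w
  path-contains-comparable {P} (linear , maximal) w w-comparable =
    maximal (λ v → P v ⊎ v ≡ w) linear′ (λ _ → inj₁) w (inj₂ refl)
    where
    linear′ : Linear (λ v → P v ⊎ v ≡ w)
    linear′ a b (inj₁ pa) (inj₁ pb) = linear a b pa pb
    linear′ a b (inj₁ pa) (inj₂ refl) = w-comparable a pa
    linear′ a b (inj₂ refl) (inj₁ pb) = comparable-sym (w-comparable b pb)
    linear′ a b (inj₂ refl) (inj₂ refl) = inj₂ (inj₁ refl)

  Interval : T → T → Pred T
  Interval y m z = (y ≤ z) × (z ≤ m)

  -- A path meeting [y, m] in z contains m, because every node of the path lies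
  -- below z ≤ m or above z > y; it then contains everything below m.
  interval-bridge : ∀ {y m} → y < m → (∀ x → y < x → Comparable x m) → IsBridge (Interval y m)
  interval-bridge {y} {m} y<m above-comparable =
    (y , inj₂ refl , inj₁ y<m) , convex , linear , on-paths
    where
    convex : Convex (Interval y m)
    convex a b z (y≤a , _) (_ , b≤m) a<z z<b = ≤-trans y≤a (inj₁ a<z) , ≤-trans (inj₁ z<b) b≤m
    linear : Linear (Interval y m)
    linear a b (_ , a≤m) (_ , b≤m) = comparable-below a≤m b≤m
    on-paths : ∀ P → IsPath P → (Interval y m ⊆ P) ⊎ (∀ x → Interval y m x → P x → ⊥)
    on-paths P path with em {∃ λ z → Interval y m z × P z}
    ... | no disjoint = inj₂ λ x x∈I x∈P → disjoint (x , x∈I , x∈P)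
    ... | yes (z , (y≤z , z≤m) , z∈P) =
      inj₁ λ w (_ , w≤m) → path-contains-comparable path w (comparable-to w w≤m)
      where
      comparable-to-m : ∀ p → P p → Comparable p m
      comparable-to-m p p∈P with proj₁ path p z p∈P z∈P
      ... | inj₁ p<z = inj₁ (<-≤-trans p<z z≤m)
      ... | inj₂ (inj₁ refl) = ≤⇒comparable z≤m
      ... | inj₂ (inj₂ z<p) = above-comparable p (≤-<-trans y≤z z<p)
      comparable-to : ∀ w → w ≤ m → ∀ p → P p → Comparable p w
      comparable-to w w≤m p p∈P
        with proj₁ path p m p∈P (path-contains-comparable path m comparable-to-m)
      ... | inj₁ p<m = comparable-below (inj₁ p<m) w≤m
      ... | inj₂ (inj₁ refl) = comparable-below (inj₂ refl) w≤m
      ... | inj₂ (inj₂ m<p) = inj₂ (inj₂ (≤-<-trans w≤m m<p))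

  singleton-bridge : ∀ a → IsBridge (_≡ a)
  singleton-bridge a = (a , refl) , convex , (λ { _ _ refl refl → inj₂ (inj₁ refl) }) , on-paths
    where
    convex : Convex (_≡ a)
    convex _ _ _ refl refl a<z z<a = ⊥-elim (irrefl refl (trans a<z z<a))
    on-paths : ∀ P → IsPath P → ((_≡ a) ⊆ P) ⊎ (∀ x → x ≡ a → P x → ⊥)
    on-paths P _ with em {P a}
    ... | yes a∈P = inj₁ λ { _ refl → a∈P }
    ... | no a∉P = inj₂ λ { _ refl → a∉P }

  class-refl : ∀ a → Class a a
  class-refl a = (_≡ a) , singleton-bridge a , refl , refl

  <c⇒< : ∀ {x y} → x <c y → x < y
  <c⇒< {x} {y} x<cy = x<cy x y (class-refl x) (class-refl y)

  -- Otherwise [y, m] is a bridge containing both y and m.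
  <c⇒incomparable-above : ∀ {y m} → y <c m → ∃ λ x → (y < x) × ¬ Comparable x m
  <c⇒incomparable-above {y} {m} y<cm with em {∃ λ x → (y < x) × ¬ Comparable x m}
  ... | yes r = r
  ... | no none = ⊥-elim (irrefl refl (y<cm y y (I , I-bridge , y∈I , y∈I) (I , I-bridge , m∈I , y∈I)))
    where
    y<m = <c⇒< y<cm
    I = Interval y m
    I-bridge : IsBridge I
    I-bridge = interval-bridge y<m λ x y<x → em⇒dne em λ ¬c → none (x , y<x , ¬c)
    y∈I : I y
    y∈I = inj₂ refl , inj₁ y<m
    m∈I : I m
    m∈I = inj₁ y<m , inj₂ refl

  module Comb (m x : ℕ → T) (m-descends : ∀ k → m (1+ k) < m k)
              (x-above : ∀ k → m (1+ k) < x k) (x-off : ∀ k → ¬ Comparable (x k) (m k)) where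

    m-antitone : ∀ {k j} → k ≤ℕ j → m j ≤ m k
    m-antitone = go ∘ ≤⇒≤′
      where
      go : ∀ {k j} → k ≤′ j → m j ≤ m k
      go ≤′-refl = inj₂ refl
      go (≤′-step k≤′j) = inj₁ (<-≤-trans (m-descends _) (go k≤′j))

    m-below-earlier-x : ∀ {i j} → i <ℕ j → m j < x i
    m-below-earlier-x i<j = ≤-<-trans (m-antitone i<j) (x-above _)

    Xs : Pred T
    Xs w = ∃ λ k → x k ≡ w

    Xs-antichain : Antichain Xs
    Xs-antichain _ _ (i , refl) (j , refl) xi<xj with <-cmp i j
    ... | tri< i<j _ _ = x-off j (inj₂ (inj₂ (trans (m-below-earlier-x i<j) xi<xj)))
    ... | tri≈ _ refl _ = irrefl refl xi<xj
    ... | tri> _ _ j<i = x-off i (comparable-below (inj₁ xi<xj) (inj₁ (m-below-earlier-x j<i)))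

    BelowAll : Pred T
    BelowAll v = ∀ k → v < m k

    BelowAll-stem : ∀ {v} → BelowAll v → IsStem BelowAll
    BelowAll-stem {v} v-below =
      (v , v-below) , (λ a b a-below b-below → comparable-below (inj₁ (a-below 0)) (inj₁ (b-below 0)))
      , (λ a b b<a a-below k → trans b<a (a-below k)) , (m 0 , λ s s-below → inj₁ (s-below 0))

    -- A node below some xⱼ is comparable with mⱼ₊₁, hence with every mₖ unless it
    -- lies above one of them.
    above-some-m : ∀ {v j} → v ≤ x j → ¬ BelowAll v → ∃ λ k → m k ≤ v
    above-some-m {v} {j} v≤xj not-below with em {∃ λ k → m k ≤ v}
    ... | yes r = r
    ... | no none = ⊥-elim (not-below below)
      where
      below-of-comparable : ∀ {k} → Comparable v (m k) → v < m k
      below-of-comparable (inj₁ v<mk) = v<mk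
      below-of-comparable (inj₂ (inj₁ refl)) = ⊥-elim (none (_ , inj₂ refl))
      below-of-comparable (inj₂ (inj₂ mk<v)) = ⊥-elim (none (_ , inj₁ mk<v))
      v≤m₀ : v ≤ m 0
      v≤m₀ = inj₁ (<-≤-trans (below-of-comparable (comparable-below v≤xj (inj₁ (x-above j))))
                             (m-antitone {0} {1+ j} z≤n))
      below : BelowAll v
      below k = below-of-comparable (comparable-below v≤m₀ (m-antitone z≤n))

    no-branching-bound : ∀ {n S} → NBranching₂At n S → (∀ k → Above S (x k)) →
                         (∀ v → Above S v → ¬ BelowAll v) → ⊥
    no-branching-bound {n} branching x-above-S above-S-not-below
      with branching Xs (λ { _ (k , refl) → x-above-S k }) Xs-antichain
    ... | L , L-above-S , _ , L-underlies , f , _ , f-onto , f-in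
      with common-witness em n (λ i k → m k ≤ f i) (λ _ k≤k′ → ≤-trans (m-antitone k≤k′))
    ... | K , K-works with L-underlies (x K) (K , refl)
    ... | v , v∈L , v≤xK with f-onto v v∈L
    ... | i , refl = x-off K (comparable-sym (≤⇒comparable (≤-trans mK≤v v≤xK)))
      where
      mK≤v : m K ≤ v
      mK≤v = K-works i (above-some-m v≤xK (above-S-not-below v (L-above-S v v∈L)))

    not-finitely-branching₂ : ¬ FinitelyBranching₂
    not-finitely-branching₂ ((_ , at-∅) , at-stem) with em {∃ BelowAll}
    ... | no none = no-branching-bound at-∅ (λ _ _ ()) λ v _ v-below → none (v , v-below)
    ... | yes (v , v-below) = no-branching-bound (proj₂ (at-stem BelowAll (BelowAll-stem v-below)))
      (λ k s s-below → trans (s-below (1+ k)) (x-above k)) λ v v-above v-below → irrefl refl (v-above v v-below)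

  no-<c-descending-sequence : FinitelyBranching₂ → ¬ (Σ (ℕ → T) λ m → ∀ k → m (1+ k) <c m k)
  no-<c-descending-sequence finBranching (m , m-descends) =
    Comb.not-finitely-branching₂ m (proj₁ ∘ branch) (<c⇒< ∘ m-descends)
      (proj₁ ∘ proj₂ ∘ branch) (proj₂ ∘ proj₂ ∘ branch) finBranching
    where
    branch = <c⇒incomparable-above ∘ m-descends

proposition4p19 : ExcludedMiddle 0ℓ → ExcludedMiddle (suc 0ℓ) → ExcludedMiddle (suc (suc 0ℓ)) →
    (T : Set) (_<_ : T → T → Set) →
    TreeNotions.IsTree _<_ → TreeNotions.FinitelyBranching₂ _<_ →
    TreeNotions.CondensationWellFounded _<_
proposition4p19 em₀ em₁ _ T _<_ isTree finBranching P (t , pt)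
  with em₁ {∃ λ m → P m × (∀ y → P y → ¬ (TreeNotions._<c_ _<_ y m))}
... | yes minimal = minimal
... | no no-minimal = ⊥-elim (no-<c-descending-sequence finBranching
                               (descending-sequence P _<c_ smaller pt))
  where
  open TreeNotions _<_
  open TreeLemmas em₀ isTree
  smaller : ∀ a → P a → Σ T λ b → P b × (b <c a)
  smaller a pa with em₁ {Σ T λ b → P b × (b <c a)}
  ... | yes r = r
  ... | no none = ⊥-elim (no-minimal (a , pa , λ b pb b<ca → none (b , pb , b<ca)))
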